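{- Let $q\ge2$, $n\ge1$ and $t\ge3$ be integers. Then \[ m_q(n,t)\le \binom{n}{\left\lceil \frac{n-t+1}{\binom{t}{2}}\right\rceil}+t. \]
   Context: Let $Q=\{0,1,\dots,q-1\}$. For a nonempty set $X=\{\mathbf c^1,\dots,\mathbf c^s\}\subseteq Q^n$, a position $i\in[n]$ is undetectable for $X$ if $c^1_i=\dots=c^s_i$; let $U(X)$ be the set of undetectable positions and $\mathrm{wdesc}(X)=\{\mathbf y\in Q^n: y_i=c^1_i \text{ for all } i\in U(X)\}$. For $t\ge2$, a code $\mathcal C\subseteq Q^n$ is a wide-sense $t$-frameproof code if $\mathrm{wdesc}(X)\cap\mathcal C=X$ for every nonempty $X\subseteq\mathcal C$ with $|X|\le t$. $m_q(n,t)$ is the maximum size of a wide-sense $t$-frameproof code in $Q^n$. Binomial coefficients with negative lower index are $0$. -}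

module Defs where

open import Data.Nat using (ℕ; zero; suc)
open import Data.Nat.Combinatorics using (_C_)
open import Data.Integer using (ℤ; +_; -[1+_]; -_; _/ℕ_)
open import Data.Fin using (Fin)
open import Data.Vec using (Vec; lookup)
open import Data.List using (List; []; _∷_; length)
open import Data.List.Membership.Propositional using (_∈_)
open import Data.List.Relation.Unary.Unique.Propositional using (Unique)
open import Data.List.Relation.Unary.Any using (Any)
open import Relation.Binary.PropositionalEquality using (_≡_)
open import Data.Nat using (_≤_)

Word : ℕ → ℕ → Set
Word q n = Vec (Fin q) n

Undetectable : ∀ {q n} → List (Word q n) → Fin n → Set
Undetectable X i = ∀ c c′ → c ∈ X → c′ ∈ X → lookup c i ≡ lookup c′ i

InWdesc : ∀ {q n} → List (Word q n) → Word q n → Set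
InWdesc X y = ∀ i → Undetectable X i → ∀ c → c ∈ X → lookup y i ≡ lookup c i

NonEmpty : ∀ {A : Set} → List A → Set
NonEmpty [] = Data.Empty.⊥ where import Data.Empty
NonEmpty (_ ∷ _) = Data.Unit.⊤ where import Data.Unit

-- A code C (list without repetitions) is a wide-sense t-frameproof code:
-- for every nonempty X ⊆ C with |X| ≤ t, wdesc(X) ∩ C = X.
-- (The inclusion X ⊆ wdesc(X) ∩ C holds automatically, so only ⊆ is stated.)
WideSenseFrameproof : ∀ {q n} → ℕ → List (Word q n) → Set
WideSenseFrameproof {q} {n} t C =
  Unique C ×′ (∀ (X : List (Word q n)) → Unique X → NonEmpty X → length X ≤ t →
     (∀ x → x ∈ X → x ∈ C) →
     ∀ y → y ∈ C → InWdesc X y → y ∈ X)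
  where open import Data.Product using () renaming (_×_ to _×′_)

-- Ceiling of a / b for b > 0 (value for b = 0 is irrelevant junk).
ceilDiv : ℤ → ℕ → ℤ
ceilDiv a zero = + 0
ceilDiv a (suc b) = - ((- a) /ℕ suc b)

binomℤ : ℕ → ℤ → ℕ
binomℤ n (+ k) = n C k
binomℤ n -[1+ _ ] = 0

{-# OPTIONS --safe #-}
-- Fix a codeword a and send every other codeword b to the set D b of positions where b
-- differs from a. The frameproof property makes these sets r-cover-free for r = t − 1: no
-- D c lies in the union of r others. Let k = ⌈(n − r)/C(r+1,2)⌉, which is never negative as
-- C(t,2) ≥ t. Call a member good if some set of at most k of its points lies in no other
-- member. These private sets form an antichain of sets of size at most k ≤ n/2, so
-- Lubell's inequality allows at most C(n,k) good members. There are at most r bad members: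
-- among r + 1 of them the i-th (from 0) adds more than (r − i)k points outside the earlier
-- ones, since otherwise the rest of it splits into pieces of at most k points lying in
-- other members, and its set would be covered by r others; so together they would cover at
-- least r + 1 + C(r+1,2)k > n points. Counting a too, the code has at most C(n,k) + t words.
module Submission where

open import Defs

import Algebra.Properties.CommutativeSemigroup as CommSemigroupProperties
open import Data.Bool using (true; false; if_then_else_)
open import Data.Fin using (Fin; zero; suc) renaming (_≟_ to _≟ᶠ_)
open import Data.Fin.Subset
  using (Subset; inside; outside; _∈_; _∉_; _⊆_; _⊈_; _∪_; _─_; ⁅_⁆; ⋃; ∣_∣; ⊤)
  renaming (⊥ to ∅)
open import Data.Fin.Subset.Properties
  using (_∈?_; _⊆?_; ⊆-trans; ⊆-antisym; ⊆⊤; ⊥⊆; out⊆; in⊆in; ∉⊥; anySubset?;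
         ∣p∣≤n; ∣⊤∣≡n; ∣⊥∣≡0; ∣⁅x⁆∣≡1; p⊆q⇒∣p∣≤∣q∣; x∈p⇒∣p-x∣<∣p∣; x∈⁅y⁆⇒x≡y;
         x∈p∪q⁺; x∈p∪q⁻; p⊆p∪q; ∪-assoc; ∪-identityˡ; x∈p∧x∉q⇒x∈p─q; x∈p∧x≢y⇒x∈p-y; p─q⊆p; p─⊥≡p)
open import Data.Vec using (Vec; []; _∷_; here; there; lookup)
open import Data.Vec.Properties using (≡-dec)
open import Data.List using (List; []; _∷_; [_]; _++_; map; filter; length; deduplicate)
open import Data.List.Properties
  using (map-cong; map-cong-local; map-++; length-++; length-map; length-deduplicate)
open import Data.List.Membership.Propositional using (find) renaming (_∈_ to _∈ₗ_)
open import Data.List.Membership.Propositional.Properties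
  using (∈-filter⁻; ∈-deduplicate⁺; ∈-deduplicate⁻)
open import Data.List.Relation.Unary.All as All using (All; []; _∷_)
import Data.List.Relation.Unary.All.Properties as All
open import Data.List.Relation.Unary.AllPairs using (AllPairs; []; _∷_)
import Data.List.Relation.Unary.AllPairs.Properties as AllPairs
open import Data.List.Relation.Unary.Unique.Propositional using (Unique)
open import Data.List.Relation.Unary.Unique.DecPropositional.Properties using (deduplicate-!)
open import Data.List.Relation.Unary.Any using (Any; here; there; any?)
import Data.List.Relation.Unary.Any.Properties as Any
open import Data.Nat using (ℕ; zero; suc; _+_; _*_; _∸_; _≤_; _<_; z≤n; s≤s; _!; _≤?_)
open import Data.Nat.Combinatorics
  using (_C_; nC1≡n; nCk+nC[k+1]≡[n+1]C[k+1]; nCk≡n!/k![n-k]!; k![n∸k]!∣n!)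
open import Data.Nat.DivMod using (m/n*n≡m)
open import Data.Nat.ListAction using (sum)
open import Data.Nat.Properties
open import Data.Nat.Tactic.RingSolver using (solve-∀)
open import Data.Empty using (⊥-elim)
open import Data.Unit using (tt)
open import Data.Product using (_×_; _,_; proj₁; proj₂; ∃-syntax)
open import Data.Sum using (inj₁; inj₂)
open import Function using (_∘_; _on_)
open import Relation.Binary.PropositionalEquality hiding ([_])
open import Relation.Binary.Definitions using (DecidableEquality)
open import Relation.Nullary using (¬_; Dec; yes; no; does; ¬?; contradiction; _×-dec_; _→-dec_)
open import Relation.Nullary.Decidable using (decidable-stable)
open import Relation.Unary using (Decidable)
open import Relation.Unary.Properties using (∁?)

open CommSemigroupProperties +-commutativeSemigroup using () renaming (interchange to +-interchange)
open CommSemigroupProperties *-commutativeSemigroup using () renaming (x∙yz≈y∙xz to *-left-comm)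

private
  variable
    n : ℕ
    x : Fin n
    p q : Subset n

∣p∣≡0⇒p⊆q : ∣ p ∣ ≡ 0 → p ⊆ q
∣p∣≡0⇒p⊆q ∣p∣≡0 x∈p = contradiction ∣p∣≡0 (m<n⇒n≢0 (x∈p⇒∣p-x∣<∣p∣ x∈p))

∣p─q∣≡0⇒p⊆q : ∣ p ─ q ∣ ≡ 0 → p ⊆ q
∣p─q∣≡0⇒p⊆q {q = q} ∣p─q∣≡0 {x} x∈p with x ∈? q
... | yes x∈q = x∈q
... | no  x∉q = ∣p∣≡0⇒p⊆q ∣p─q∣≡0 (x∈p∧x∉q⇒x∈p─q x∈p x∉q)

∣p∪q∣≡∣q∣+∣p─q∣ : ∀ (p q : Subset n) → ∣ p ∪ q ∣ ≡ ∣ q ∣ + ∣ p ─ q ∣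
∣p∪q∣≡∣q∣+∣p─q∣ []            []            = refl
∣p∪q∣≡∣q∣+∣p─q∣ (inside  ∷ p) (inside  ∷ q) = cong suc (∣p∪q∣≡∣q∣+∣p─q∣ p q)
∣p∪q∣≡∣q∣+∣p─q∣ (inside  ∷ p) (outside ∷ q) =
  trans (cong suc (∣p∪q∣≡∣q∣+∣p─q∣ p q)) (sym (+-suc ∣ q ∣ ∣ p ─ q ∣))
∣p∪q∣≡∣q∣+∣p─q∣ (outside ∷ p) (inside  ∷ q) = cong suc (∣p∪q∣≡∣q∣+∣p─q∣ p q)
∣p∪q∣≡∣q∣+∣p─q∣ (outside ∷ p) (outside ∷ q) = ∣p∪q∣≡∣q∣+∣p─q∣ p q

q⊆p⇒∣q∣+∣p─q∣≡∣p∣ : q ⊆ p → ∣ q ∣ + ∣ p ─ q ∣ ≡ ∣ p ∣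
q⊆p⇒∣q∣+∣p─q∣≡∣p∣ {q = q} {p = p} q⊆p = begin
  ∣ q ∣ + ∣ p ─ q ∣ ≡⟨ ∣p∪q∣≡∣q∣+∣p─q∣ p q ⟨
  ∣ p ∪ q ∣         ≡⟨ cong ∣_∣ (⊆-antisym p∪q⊆p (p⊆p∪q q)) ⟩
  ∣ p ∣             ∎
  where
  open ≡-Reasoning
  p∪q⊆p : p ∪ q ⊆ p
  p∪q⊆p x∈p∪q with x∈p∪q⁻ p q x∈p∪q
  ... | inj₁ x∈p = x∈p
  ... | inj₂ x∈q = q⊆p x∈q

x∈p⇒1+∣p─⁅x⁆∣≡∣p∣ : x ∈ p → suc ∣ p ─ ⁅ x ⁆ ∣ ≡ ∣ p ∣
x∈p⇒1+∣p─⁅x⁆∣≡∣p∣ {x = x} {p = p} x∈p =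
  trans (cong (_+ ∣ p ─ ⁅ x ⁆ ∣) (sym (∣⁅x⁆∣≡1 x))) (q⊆p⇒∣q∣+∣p─q∣≡∣p∣ ⁅x⁆⊆p)
  where
  ⁅x⁆⊆p : ⁅ x ⁆ ⊆ p
  ⁅x⁆⊆p y∈⁅x⁆ rewrite x∈⁅y⁆⇒x≡y x y∈⁅x⁆ = x∈p

p⊆q∧q⊈p⇒∣p∣<∣q∣ : p ⊆ q → q ⊈ p → ∣ p ∣ < ∣ q ∣
p⊆q∧q⊈p⇒∣p∣<∣q∣ {p = p} {q = q} p⊆q q⊈p with m≤n⇒m<n∨m≡n (p⊆q⇒∣p∣≤∣q∣ p⊆q)
... | inj₁ ∣p∣<∣q∣ = ∣p∣<∣q∣
... | inj₂ ∣p∣≡∣q∣ = ⊥-elim (q⊈p (∣p─q∣≡0⇒p⊆q ∣q─p∣≡0))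
  where
  ∣q─p∣≡0 : ∣ q ─ p ∣ ≡ 0
  ∣q─p∣≡0 = +-cancelˡ-≡ ∣ p ∣ _ _
    (trans (q⊆p⇒∣q∣+∣p─q∣≡∣p∣ p⊆q) (trans (sym ∣p∣≡∣q∣) (sym (+-identityʳ ∣ p ∣))))

p─q⊆r⇒p⊆q∪r : ∀ {r : Subset n} → p ─ q ⊆ r → p ⊆ q ∪ r
p─q⊆r⇒p⊆q∪r {q = q} p─q⊆r {x} x∈p with x ∈? q
... | yes x∈q = x∈p∪q⁺ (inj₁ x∈q)
... | no  x∉q = x∈p∪q⁺ (inj₂ (p─q⊆r (x∈p∧x∉q⇒x∈p─q x∈p x∉q)))

⋃-++ : ∀ (ps qs : List (Subset n)) → ⋃ (ps ++ qs) ≡ ⋃ ps ∪ ⋃ qs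
⋃-++ []       qs = sym (∪-identityˡ (⋃ qs))
⋃-++ (p ∷ ps) qs = trans (cong (p ∪_) (⋃-++ ps qs)) (sym (∪-assoc p (⋃ ps) (⋃ qs)))

x∈⋃ps⁻ : ∀ (ps : List (Subset n)) → x ∈ ⋃ ps → Any (x ∈_) ps
x∈⋃ps⁻ []       x∈⊥ = contradiction x∈⊥ ∉⊥
x∈⋃ps⁻ (p ∷ ps) x∈⋃ with x∈p∪q⁻ p (⋃ ps) x∈⋃
... | inj₁ x∈p  = here x∈p
... | inj₂ x∈⋃ps = there (x∈⋃ps⁻ ps x∈⋃ps)

-- Sums over a subset and Lubell's inequality

∑∈ : Subset n → (Fin n → ℕ) → ℕ
∑∈ []            f = 0
∑∈ (inside  ∷ p) f = f zero + ∑∈ p (f ∘ suc)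
∑∈ (outside ∷ p) f = ∑∈ p (f ∘ suc)

syntax ∑∈ p (λ x → e) = ∑[ x ∈ p ] e

∑∈-const : ∀ (p : Subset n) c → ∑[ x ∈ p ] c ≡ ∣ p ∣ * c
∑∈-const []            c = refl
∑∈-const (inside  ∷ p) c = cong (c +_) (∑∈-const p c)
∑∈-const (outside ∷ p) c = ∑∈-const p c

∑∈-distrib-+ : ∀ (p : Subset n) f g → ∑[ x ∈ p ] (f x + g x) ≡ ∑∈ p f + ∑∈ p g
∑∈-distrib-+ []            f g = refl
∑∈-distrib-+ (inside  ∷ p) f g = begin
  f zero + g zero + ∑[ x ∈ p ] (f (suc x) + g (suc x))
    ≡⟨ cong (f zero + g zero +_) (∑∈-distrib-+ p (f ∘ suc) (g ∘ suc)) ⟩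
  f zero + g zero + (∑∈ p (f ∘ suc) + ∑∈ p (g ∘ suc))
    ≡⟨ +-interchange (f zero) (g zero) _ _ ⟩
  f zero + ∑∈ p (f ∘ suc) + (g zero + ∑∈ p (g ∘ suc)) ∎
  where open ≡-Reasoning
∑∈-distrib-+ (outside ∷ p) f g = ∑∈-distrib-+ p (f ∘ suc) (g ∘ suc)

∑∈-cong : ∀ (p : Subset n) {f g} → (∀ x → f x ≡ g x) → ∑∈ p f ≡ ∑∈ p g
∑∈-cong []            f≗g = refl
∑∈-cong (inside  ∷ p) f≗g = cong₂ _+_ (f≗g zero) (∑∈-cong p (f≗g ∘ suc))
∑∈-cong (outside ∷ p) f≗g = ∑∈-cong p (f≗g ∘ suc)

∑∈-mono-≤ : ∀ (p : Subset n) {f g} → (∀ {x} → x ∈ p → f x ≤ g x) → ∑∈ p f ≤ ∑∈ p g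
∑∈-mono-≤ []            f≤g = z≤n
∑∈-mono-≤ (inside  ∷ p) f≤g = +-mono-≤ (f≤g here) (∑∈-mono-≤ p (f≤g ∘ there))
∑∈-mono-≤ (outside ∷ p) f≤g = ∑∈-mono-≤ p (f≤g ∘ there)

_∉?_ : ∀ (x : Fin n) p → Dec (x ∉ p)
x ∉? p = ¬? (x ∈? p)

∑∈-∉ : ∀ (p q : Subset n) c → ∑[ x ∈ p ] (if does (x ∉? q) then c else 0) ≡ ∣ p ─ q ∣ * c
∑∈-∉ []            []            c = refl
∑∈-∉ (inside  ∷ p) (inside  ∷ q) c = ∑∈-∉ p q c
∑∈-∉ (inside  ∷ p) (outside ∷ q) c = cong (c +_) (∑∈-∉ p q c)
∑∈-∉ (outside ∷ p) (inside  ∷ q) c = ∑∈-∉ p q c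
∑∈-∉ (outside ∷ p) (outside ∷ q) c = ∑∈-∉ p q c

∑∈-sum-comm : ∀ {A : Set} (p : Subset n) (f : Fin n → A → ℕ) as →
  ∑[ x ∈ p ] sum (map (f x) as) ≡ sum (map (λ a → ∑[ x ∈ p ] f x a) as)
∑∈-sum-comm p f []       = trans (∑∈-const p 0) (*-zeroʳ ∣ p ∣)
∑∈-sum-comm p f (a ∷ as) =
  trans (∑∈-distrib-+ p (λ x → f x a) (λ x → sum (map (f x) as)))
        (cong (∑[ x ∈ p ] f x a +_) (∑∈-sum-comm p f as))

sum-map-filter : ∀ {A : Set} {P : A → Set} (P? : Decidable P) (g : A → ℕ) as →
  sum (map g (filter P? as)) ≡ sum (map (λ a → if does (P? a) then g a else 0) as)
sum-map-filter P? g []       = refl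
sum-map-filter P? g (a ∷ as) with does (P? a)
... | true  = cong (g a +_) (sum-map-filter P? g as)
... | false = sum-map-filter P? g as

double-count : ∀ (U : Subset n) (g : Subset n → ℕ) Ts →
  sum (map (λ T → ∣ U ─ T ∣ * g T) Ts) ≡ ∑[ x ∈ U ] sum (map g (filter (x ∉?_) Ts))
double-count U g Ts = begin
  sum (map (λ T → ∣ U ─ T ∣ * g T) Ts)
    ≡⟨ cong sum (map-cong (λ T → ∑∈-∉ U T (g T)) Ts) ⟨
  sum (map (λ T → ∑[ x ∈ U ] (if does (x ∉? T) then g T else 0)) Ts)
    ≡⟨ ∑∈-sum-comm U (λ x T → if does (x ∉? T) then g T else 0) Ts ⟨
  ∑[ x ∈ U ] sum (map (λ T → if does (x ∉? T) then g T else 0) Ts)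
    ≡⟨ ∑∈-cong U (λ x → sum-map-filter (x ∉?_) g Ts) ⟨
  ∑[ x ∈ U ] sum (map g (filter (x ∉?_) Ts)) ∎
  where open ≡-Reasoning

Incomparable : Subset n → Subset n → Set
Incomparable p q = p ⊈ q × q ⊈ p

-- The number of maximal chains of an m-element set that pass through T.
weight : ℕ → Subset n → ℕ
weight m T = ∣ T ∣ ! * (m ∸ ∣ T ∣) !

weight-suc : ∀ {m} {T U : Subset n} → T ⊆ U → U ⊈ T → ∣ U ∣ ≡ suc m →
  weight (suc m) T ≡ ∣ U ─ T ∣ * weight m T
weight-suc {m = m} {T} {U} T⊆U U⊈T ∣U∣≡1+m = begin
  ∣ T ∣ ! * (suc m ∸ ∣ T ∣) !    ≡⟨ cong (λ d → ∣ T ∣ ! * d !) (+-∸-assoc 1 ∣T∣≤m) ⟩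
  ∣ T ∣ ! * suc (m ∸ ∣ T ∣) !    ≡⟨ *-left-comm (∣ T ∣ !) (suc (m ∸ ∣ T ∣)) ((m ∸ ∣ T ∣) !) ⟩
  suc (m ∸ ∣ T ∣) * weight m T   ≡⟨ cong (_* weight m T) ∣U─T∣≡1+[m∸∣T∣] ⟨
  ∣ U ─ T ∣ * weight m T         ∎
  where
  open ≡-Reasoning
  ∣T∣≤m : ∣ T ∣ ≤ m
  ∣T∣≤m = ≤-pred (subst (∣ T ∣ <_) ∣U∣≡1+m (p⊆q∧q⊈p⇒∣p∣<∣q∣ T⊆U U⊈T))
  ∣U─T∣≡1+[m∸∣T∣] : ∣ U ─ T ∣ ≡ suc (m ∸ ∣ T ∣)
  ∣U─T∣≡1+[m∸∣T∣] = begin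
    ∣ U ─ T ∣                    ≡⟨ m+n∸m≡n ∣ T ∣ _ ⟨
    ∣ T ∣ + ∣ U ─ T ∣ ∸ ∣ T ∣    ≡⟨ cong (_∸ ∣ T ∣) (trans (q⊆p⇒∣q∣+∣p─q∣≡∣p∣ T⊆U) ∣U∣≡1+m) ⟩
    suc m ∸ ∣ T ∣                ≡⟨ +-∸-assoc 1 ∣T∣≤m ⟩
    suc (m ∸ ∣ T ∣)              ∎

antichain∋U⇒≡[U] : ∀ {U : Subset n} {Ts} → All (_⊆ U) Ts → AllPairs Incomparable Ts →
  Any (U ⊆_) Ts → Ts ≡ [ U ]
antichain∋U⇒≡[U] (T⊆U ∷ [])        _                 (here U⊆T)  = cong [_] (⊆-antisym T⊆U U⊆T)
antichain∋U⇒≡[U] (_ ∷ T′⊆U ∷ _)    ((T⋈T′ ∷ _) ∷ _) (here U⊆T)  =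
  ⊥-elim (proj₂ T⋈T′ (⊆-trans T′⊆U U⊆T))
antichain∋U⇒≡[U] {U = U} (T⊆U ∷ _) (T⋈Ts ∷ _) (there U∈Ts) =
  contradiction U∈Ts (All.All¬⇒¬Any (All.map U⊈ T⋈Ts))
  where
  U⊈ : ∀ {T′} → Incomparable _ T′ → U ⊈ T′
  U⊈ T⋈T′ U⊆T′ = proj₁ T⋈T′ (⊆-trans T⊆U U⊆T′)

lubell : ∀ m (U : Subset n) → ∣ U ∣ ≡ m → (Ts : List (Subset n)) →
  All (_⊆ U) Ts → AllPairs Incomparable Ts → sum (map (weight m) Ts) ≤ m !
lubell m U ∣U∣≡m Ts Ts⊆U antichain with any? (U ⊆?_) Ts
... | yes U∈Ts rewrite antichain∋U⇒≡[U] Ts⊆U antichain U∈Ts | ∣U∣≡m | n∸n≡0 m =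
  ≤-reflexive (trans (+-identityʳ _) (*-identityʳ _))
lubell zero    U ∣U∣≡0   []      _    _ | no _     = z≤n
lubell zero    U ∣U∣≡0   (T ∷ _) _    _ | no U∉Ts = ⊥-elim (U∉Ts (here (∣p∣≡0⇒p⊆q ∣U∣≡0)))
lubell (suc m) U ∣U∣≡1+m Ts      Ts⊆U antichain | no U∉Ts = begin
  sum (map (weight (suc m)) Ts)               ≡⟨ cong sum (map-cong-local weights) ⟩
  sum (map (λ T → ∣ U ─ T ∣ * weight m T) Ts)  ≡⟨ double-count U (weight m) Ts ⟩
  ∑[ x ∈ U ] sum (map (weight m) (filter (x ∉?_) Ts)) ≤⟨ ∑∈-mono-≤ U avoiding ⟩
  ∑[ x ∈ U ] (m !)                            ≡⟨ ∑∈-const U (m !) ⟩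
  ∣ U ∣ * m !                                 ≡⟨ cong (_* m !) ∣U∣≡1+m ⟩
  suc m !                                     ∎
  where
  open ≤-Reasoning
  weights : All (λ T → weight (suc m) T ≡ ∣ U ─ T ∣ * weight m T) Ts
  weights = All.zipWith weight-of (Ts⊆U , All.¬Any⇒All¬ Ts U∉Ts)
    where
    weight-of : ∀ {T} → T ⊆ U × U ⊈ T → weight (suc m) T ≡ ∣ U ─ T ∣ * weight m T
    weight-of (T⊆U , U⊈T) = weight-suc T⊆U U⊈T ∣U∣≡1+m
  avoiding : ∀ {x} → x ∈ U → sum (map (weight m) (filter (x ∉?_) Ts)) ≤ m !
  avoiding {x} x∈U = lubell m (U ─ ⁅ x ⁆) (suc-injective (trans (x∈p⇒1+∣p─⁅x⁆∣≡∣p∣ x∈U) ∣U∣≡1+m))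
    (filter (x ∉?_) Ts)
    (All.zipWith T⊆U─⁅x⁆ (All.all-filter (x ∉?_) Ts , All.filter⁺ (x ∉?_) Ts⊆U))
    (AllPairs.filter⁺ (x ∉?_) antichain)
    where
    T⊆U─⁅x⁆ : ∀ {T} → x ∉ T × T ⊆ U → T ⊆ U ─ ⁅ x ⁆
    T⊆U─⁅x⁆ (x∉T , T⊆U) y∈T = x∈p∧x≢y⇒x∈p-y (T⊆U y∈T) (λ { refl → x∉T y∈T })

[1+k]!*d!≤k!*[1+d]! : ∀ {k d} → k ≤ d → suc k ! * d ! ≤ k ! * suc d !
[1+k]!*d!≤k!*[1+d]! {k} {d} k≤d = begin
  suc k ! * d !        ≡⟨ *-assoc (suc k) (k !) (d !) ⟩
  suc k * (k ! * d !)  ≤⟨ *-monoˡ-≤ (k ! * d !) (s≤s k≤d) ⟩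
  suc d * (k ! * d !)  ≡⟨ *-left-comm (suc d) (k !) (d !) ⟩
  k ! * suc d !        ∎
  where open ≤-Reasoning

k!*[n∸k]!-antitone : ∀ {n j k} → j ≤ k → k + k ≤ n → k ! * (n ∸ k) ! ≤ j ! * (n ∸ j) !
k!*[n∸k]!-antitone {n} {j} {zero}  z≤n _ = ≤-refl
k!*[n∸k]!-antitone {n} {j} {suc k} j≤1+k 2+2k≤n with m≤n⇒m<n∨m≡n j≤1+k
... | inj₂ refl        = ≤-refl
... | inj₁ (s≤s j≤k) = begin
  suc k ! * (n ∸ suc k) !  ≤⟨ [1+k]!*d!≤k!*[1+d]! k≤n∸1+k ⟩
  k ! * suc (n ∸ suc k) !  ≡⟨ cong (λ d → k ! * d !) (+-∸-assoc 1 1+k≤n) ⟨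
  k ! * (n ∸ k) !          ≤⟨ k!*[n∸k]!-antitone j≤k 2k≤n ⟩
  j ! * (n ∸ j) !          ∎
  where
  open ≤-Reasoning
  2k≤n : k + k ≤ n
  2k≤n = ≤-trans (+-mono-≤ (n≤1+n k) (n≤1+n k)) 2+2k≤n
  1+k≤n : suc k ≤ n
  1+k≤n = ≤-trans (m≤m+n (suc k) (suc k)) 2+2k≤n
  k≤n∸1+k : k ≤ n ∸ suc k
  k≤n∸1+k = subst (_≤ n ∸ suc k) (m+n∸n≡m k (suc k)) (∸-monoˡ-≤ (suc k) (≤-trans (n≤1+n _) 2+2k≤n))

nCk*k!*[n∸k]!≡n! : ∀ {n k} → k ≤ n → (n C k) * (k ! * (n ∸ k) !) ≡ n !
nCk*k!*[n∸k]!≡n! {n} {k} k≤n = trans (cong (_* (k ! * (n ∸ k) !)) (nCk≡n!/k![n-k]! k≤n))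
  (m/n*n≡m {{k !* (n ∸ k) !≢0}} (k![n∸k]!∣n! k≤n))

length*≤sum-map : ∀ {A : Set} {f : A → ℕ} {c} {as} → All (λ a → c ≤ f a) as →
  length as * c ≤ sum (map f as)
length*≤sum-map []         = z≤n
length*≤sum-map (c≤ ∷ c≤s) = +-mono-≤ c≤ (length*≤sum-map c≤s)

antichain-length≤nCk : ∀ k → k + k ≤ n → (Ts : List (Subset n)) →
  All (λ T → ∣ T ∣ ≤ k) Ts → AllPairs Incomparable Ts → length Ts ≤ n C k
antichain-length≤nCk {n} k 2k≤n Ts small antichain =
  *-cancelʳ-≤ (length Ts) (n C k) (k ! * (n ∸ k) !) {{k !* (n ∸ k) !≢0}} (begin
    length Ts * (k ! * (n ∸ k) !)
      ≤⟨ length*≤sum-map (All.map (λ ∣T∣≤k → k!*[n∸k]!-antitone ∣T∣≤k 2k≤n) small) ⟩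
    sum (map (weight n) Ts)
      ≤⟨ lubell n ⊤ (∣⊤∣≡n n) Ts (All.tabulate (λ _ → ⊆⊤)) antichain ⟩
    n !
      ≡⟨ nCk*k!*[n∸k]!≡n! (≤-trans (m≤m+n k k) 2k≤n) ⟨
    (n C k) * (k ! * (n ∸ k) !) ∎)
  where open ≤-Reasoning

-- Cover-free families

split-off : ∀ k (p : Subset n) → ∃[ q ] q ⊆ p × ∣ q ∣ ≤ k × ∣ p ─ q ∣ ≡ ∣ p ∣ ∸ k
split-off         k       []            = [] , (λ x∈q → x∈q) , z≤n , sym (0∸n≡0 k)
split-off         k       (outside ∷ p) with split-off k p
... | q , q⊆p , ∣q∣≤k , ∣p─q∣≡ = outside ∷ q , out⊆ q⊆p , ∣q∣≤k , ∣p─q∣≡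
split-off {suc n} zero    (inside  ∷ p) =
  ∅ , ⊥⊆ , ≤-reflexive (∣⊥∣≡0 (suc n)) , cong ∣_∣ (p─⊥≡p (inside ∷ p))
split-off         (suc k) (inside  ∷ p) with split-off k p
... | q , q⊆p , ∣q∣≤k , ∣p─q∣≡ = inside ∷ q , in⊆in q⊆p , s≤s ∣q∣≤k , ∣p─q∣≡

cover-in-pieces : ∀ {A : Set} (D : A → Subset n) (P : A → Set) k j (R : Subset n) →
  (∀ {T} → T ⊆ R → ∣ T ∣ ≤ k → ∃[ G ] P G × T ⊆ D G) → ∣ R ∣ ≤ j * k →
  ∃[ Gs ] length Gs ≤ j × All P Gs × R ⊆ ⋃ (map D Gs)
cover-in-pieces D P k zero    R _ ∣R∣≤0 = [] , z≤n , [] , ∣p∣≡0⇒p⊆q (n≤0⇒n≡0 ∣R∣≤0)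
cover-in-pieces D P k (suc j) R covered ∣R∣≤[1+j]k with split-off k R
... | T , T⊆R , ∣T∣≤k , ∣R─T∣≡∣R∣∸k
    with covered T⊆R ∣T∣≤k
       | cover-in-pieces D P k j (R ─ T) (λ T′⊆R─T → covered (⊆-trans T′⊆R─T (p─q⊆p R T))) ∣R─T∣≤jk
  where
  ∣R─T∣≤jk : ∣ R ─ T ∣ ≤ j * k
  ∣R─T∣≤jk = begin
    ∣ R ─ T ∣            ≡⟨ ∣R─T∣≡∣R∣∸k ⟩
    ∣ R ∣ ∸ k            ≤⟨ ∸-monoˡ-≤ k ∣R∣≤[1+j]k ⟩
    k + j * k ∸ k        ≡⟨ m+n∸m≡n k (j * k) ⟩
    j * k                ∎
    where open ≤-Reasoning
... | G , PG , T⊆DG | Gs , ∣Gs∣≤j , PGs , R─T⊆⋃Gs = G ∷ Gs , s≤s ∣Gs∣≤j , PG ∷ PGs , R⊆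
  where
  R⊆ : R ⊆ D G ∪ ⋃ (map D Gs)
  R⊆ x∈R with x∈p∪q⁻ T _ (p─q⊆r⇒p⊆q∪r R─T⊆⋃Gs x∈R)
  ... | inj₁ x∈T   = x∈p∪q⁺ (inj₁ (T⊆DG x∈T))
  ... | inj₂ x∈⋃Gs = x∈p∪q⁺ (inj₂ x∈⋃Gs)

length-filter+filter∁ : ∀ {A : Set} {P : A → Set} (P? : Decidable P) as →
  length (filter P? as) + length (filter (∁? P?) as) ≡ length as
length-filter+filter∁ P? []       = refl
length-filter+filter∁ P? (a ∷ as) with does (P? a)
... | true  = cong suc (length-filter+filter∁ P? as)
... | false = trans (+-suc _ _) (cong suc (length-filter+filter∁ P? as))

[1+m]C2≡m+mC2 : ∀ m → suc m C 2 ≡ m + m C 2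
[1+m]C2≡m+mC2 m = trans (sym (nCk+nC[k+1]≡[n+1]C[k+1] m 1)) (cong (_+ m C 2) (nC1≡n m))

CoverFree : ∀ {A : Set} → (A → Subset n) → ℕ → List A → Set
CoverFree D r L = ∀ {c} → c ∈ₗ L → ∀ Bs → All (λ b → b ∈ₗ L × b ≢ c) Bs → length Bs ≤ r →
  D c ⊈ ⋃ (map D Bs)

module CoverFreeFamily {A : Set} (_≟_ : DecidableEquality A) (D : A → Subset n) (L : List A)
  (r k : ℕ) (coverFree : CoverFree D r L) where

  Private : Subset n → A → Set
  Private T F = T ⊆ D F × All (λ G → T ⊆ D G → G ≡ F) L

  HasSmallPrivate : A → Set
  HasSmallPrivate F = ∃[ T ] ∣ T ∣ ≤ k × Private T F

  hasSmallPrivate? : Decidable HasSmallPrivate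
  hasSmallPrivate? F = anySubset? λ T →
    (∣ T ∣ ≤? k) ×-dec (T ⊆? D F) ×-dec All.all? (λ G → (T ⊆? D G) →-dec (G ≟ F)) L

  ¬HasSmallPrivate⇒shared : ∀ {F T} → ¬ HasSmallPrivate F → T ⊆ D F → ∣ T ∣ ≤ k →
    ∃[ G ] (G ∈ₗ L × G ≢ F) × T ⊆ D G
  ¬HasSmallPrivate⇒shared {F} {T} ¬private T⊆DF ∣T∣≤k
    with find (All.¬All⇒Any¬ (λ G → (T ⊆? D G) →-dec (G ≟ F)) L
                              (λ unique → ¬private (T , ∣T∣≤k , T⊆DF , unique)))
  ... | G , G∈L , ¬[T⊆DG⇒G≡F] =
    G , (G∈L , λ G≡F → ¬[T⊆DG⇒G≡F] (λ _ → G≡F)) ,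
    decidable-stable (T ⊆? D G) (λ T⊈DG → ¬[T⊆DG⇒G≡F] (λ T⊆DG → ⊥-elim (T⊈DG T⊆DG)))

  unshared-part-large : ∀ {F m} → F ∈ₗ L → ¬ HasSmallPrivate F → ∀ Ps →
    All (λ P → P ∈ₗ L × P ≢ F) Ps → length Ps + m ≤ r → m * k < ∣ D F ─ ⋃ (map D Ps) ∣
  unshared-part-large {F} {m} F∈L ¬private Ps Ps-others ∣Ps∣+m≤r
    with ∣ D F ─ ⋃ (map D Ps) ∣ ≤? m * k
  ... | no  ≰mk = ≰⇒> ≰mk
  ... | yes ≤mk
    with cover-in-pieces D (λ G → G ∈ₗ L × G ≢ F) k m (D F ─ ⋃ (map D Ps))
           (λ T⊆ → ¬HasSmallPrivate⇒shared ¬private (⊆-trans T⊆ (p─q⊆p (D F) _))) ≤mk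
  ... | Gs , ∣Gs∣≤m , Gs-others , ⊆⋃Gs =
    ⊥-elim (coverFree F∈L (Ps ++ Gs) (All.++⁺ Ps-others Gs-others) ∣Ps++Gs∣≤r DF⊆⋃)
    where
    ∣Ps++Gs∣≤r : length (Ps ++ Gs) ≤ r
    ∣Ps++Gs∣≤r =
      ≤-trans (≤-reflexive (length-++ Ps)) (≤-trans (+-monoʳ-≤ (length Ps) ∣Gs∣≤m) ∣Ps∣+m≤r)
    DF⊆⋃ : D F ⊆ ⋃ (map D (Ps ++ Gs))
    DF⊆⋃ rewrite map-++ D Ps Gs | ⋃-++ (map D Ps) (map D Gs) = p─q⊆r⇒p⊆q∪r ⊆⋃Gs

  -- m members are still missing to reach r + 1. A member after whose addition m are missing
  -- brings more than m k new points, and C(m+1,2) = m + C(m,2) makes these gains telescope.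
  union-grows : ∀ Ps → AllPairs _≢_ Ps → All (λ P → P ∈ₗ L × ¬ HasSmallPrivate P) Ps →
    ∀ m → length Ps + m ≡ suc r →
    length Ps + (suc r C 2) * k ≤ ∣ ⋃ (map D Ps) ∣ + (m C 2) * k
  union-grows [] [] [] m refl = ≤-reflexive (cong (_+ (m C 2) * k) (sym (∣⊥∣≡0 n)))
  union-grows (F ∷ Ps) (F∉Ps ∷ distinct) ((F∈L , ¬private) ∷ Ps-ok) m ∣F∷Ps∣+m≡1+r = begin
    suc (length Ps + (suc r C 2) * k)
      ≤⟨ s≤s (union-grows Ps distinct Ps-ok (suc m) (trans (+-suc _ m) ∣F∷Ps∣+m≡1+r)) ⟩
    suc (∣ ⋃Ps ∣ + (suc m C 2) * k)
      ≡⟨ cong (λ c → suc (∣ ⋃Ps ∣ + c * k)) ([1+m]C2≡m+mC2 m) ⟩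
    suc (∣ ⋃Ps ∣ + (m + m C 2) * k)
      ≡⟨ regroup ∣ ⋃Ps ∣ m (m C 2) k ⟩
    ∣ ⋃Ps ∣ + suc (m * k) + (m C 2) * k
      ≤⟨ +-monoˡ-≤ ((m C 2) * k) (+-monoʳ-≤ ∣ ⋃Ps ∣
           (unshared-part-large F∈L ¬private Ps Ps-others ∣Ps∣+m≤r)) ⟩
    ∣ ⋃Ps ∣ + ∣ D F ─ ⋃Ps ∣ + (m C 2) * k
      ≡⟨ cong (_+ (m C 2) * k) (∣p∪q∣≡∣q∣+∣p─q∣ (D F) ⋃Ps) ⟨
    ∣ D F ∪ ⋃Ps ∣ + (m C 2) * k ∎
    where
    open ≤-Reasoning
    ⋃Ps : Subset n
    ⋃Ps = ⋃ (map D Ps)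
    regroup : ∀ a m c k → suc (a + (m + c) * k) ≡ a + suc (m * k) + c * k
    regroup = solve-∀
    Ps-others : All (λ P → P ∈ₗ L × P ≢ F) Ps
    Ps-others = All.zipWith (λ ((P∈L , _) , F≢P) → P∈L , ≢-sym F≢P) (Ps-ok , F∉Ps)
    ∣Ps∣+m≤r : length Ps + m ≤ r
    ∣Ps∣+m≤r = ≤-reflexive (suc-injective ∣F∷Ps∣+m≡1+r)

  without-small-private-length≤r : n ≤ r + (suc r C 2) * k → ∀ Ps → AllPairs _≢_ Ps →
    All (λ P → P ∈ₗ L × ¬ HasSmallPrivate P) Ps → length Ps ≤ r
  without-small-private-length≤r n≤ [] _ _ = z≤n
  without-small-private-length≤r n≤ (F ∷ Ps) (F∉Ps ∷ distinct) (F-ok ∷ Ps-ok)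
    with m≤n⇒m<n∨m≡n (without-small-private-length≤r n≤ Ps distinct Ps-ok)
  ... | inj₁ ∣Ps∣<r = ∣Ps∣<r
  ... | inj₂ ∣Ps∣≡r = ⊥-elim (1+n≰n (begin
    suc r + (suc r C 2) * k
      ≡⟨ cong (λ l → suc l + (suc r C 2) * k) ∣Ps∣≡r ⟨
    length (F ∷ Ps) + (suc r C 2) * k
      ≤⟨ union-grows (F ∷ Ps) (F∉Ps ∷ distinct) (F-ok ∷ Ps-ok) 0
           (trans (+-identityʳ _) (cong suc ∣Ps∣≡r)) ⟩
    ∣ ⋃ (map D (F ∷ Ps)) ∣ + 0
      ≤⟨ +-monoˡ-≤ 0 (∣p∣≤n (⋃ (map D (F ∷ Ps)))) ⟩
    n + 0
      ≡⟨ +-identityʳ n ⟩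
    n
      ≤⟨ n≤ ⟩
    r + (suc r C 2) * k ∎))
    where open ≤-Reasoning

  privateSet : A → Subset n
  privateSet F with hasSmallPrivate? F
  ... | yes (T , _) = T
  ... | no  _       = ∅

  privateSet-spec : ∀ {F} → HasSmallPrivate F → ∣ privateSet F ∣ ≤ k × Private (privateSet F) F
  privateSet-spec {F} has with hasSmallPrivate? F
  ... | yes (_ , spec) = spec
  ... | no  ¬has       = contradiction has ¬has

  privateSets-incomparable : ∀ {F G} → F ∈ₗ L × HasSmallPrivate F → G ∈ₗ L × HasSmallPrivate G →
    F ≢ G → Incomparable (privateSet F) (privateSet G)
  privateSets-incomparable (F∈L , hasF) (G∈L , hasG) F≢G =
    (λ TF⊆TG → F≢G (sym (only-owner hasF G∈L (⊆-trans TF⊆TG (private⊆ hasG))))) ,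
    (λ TG⊆TF → F≢G (only-owner hasG F∈L (⊆-trans TG⊆TF (private⊆ hasF))))
    where
    private⊆ : ∀ {F} → HasSmallPrivate F → privateSet F ⊆ D F
    private⊆ has = proj₁ (proj₂ (privateSet-spec has))
    only-owner : ∀ {F G} → HasSmallPrivate F → G ∈ₗ L → privateSet F ⊆ D G → G ≡ F
    only-owner has G∈L = All.lookup (proj₂ (proj₂ (privateSet-spec has))) G∈L

  with-small-private-length≤nCk : k + k ≤ n → ∀ Fs → AllPairs _≢_ Fs →
    All (λ F → F ∈ₗ L × HasSmallPrivate F) Fs → length Fs ≤ n C k
  with-small-private-length≤nCk 2k≤n Fs distinct Fs-ok =
    subst (_≤ n C k) (length-map privateSet Fs)
      (antichain-length≤nCk k 2k≤n (map privateSet Fs)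
        (All.map⁺ (All.map (proj₁ ∘ privateSet-spec ∘ proj₂) Fs-ok))
        (AllPairs.map⁺ (antichain distinct Fs-ok)))
    where
    antichain : ∀ {Fs} → AllPairs _≢_ Fs → All (λ F → F ∈ₗ L × HasSmallPrivate F) Fs →
      AllPairs (Incomparable on privateSet) Fs
    antichain []                 []             = []
    antichain (F∉Fs ∷ distinct) (F-ok ∷ Fs-ok) =
      All.zipWith (λ (G-ok , F≢G) → privateSets-incomparable F-ok G-ok F≢G) (Fs-ok , F∉Fs)
      ∷ antichain distinct Fs-ok

  length≤nCk+r : Unique L → k + k ≤ n → n ≤ r + (suc r C 2) * k → length L ≤ n C k + r
  length≤nCk+r distinct 2k≤n n≤ = begin
    length L
      ≡⟨ length-filter+filter∁ hasSmallPrivate? L ⟨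
    length (filter hasSmallPrivate? L) + length (filter (∁? hasSmallPrivate?) L)
      ≤⟨ +-mono-≤
           (with-small-private-length≤nCk 2k≤n _ (AllPairs.filter⁺ _ distinct)
             (members hasSmallPrivate?))
           (without-small-private-length≤r n≤ _ (AllPairs.filter⁺ _ distinct)
             (members (∁? hasSmallPrivate?))) ⟩
    n C k + r ∎
    where
    open ≤-Reasoning
    members : ∀ {P : A → Set} (P? : Decidable P) → All (λ F → F ∈ₗ L × P F) (filter P? L)
    members P? = All.tabulate (∈-filter⁻ P?)

-- Difference sets of a frameproof code

module _ {A : Set} (_≟_ : DecidableEquality A) where

  differ : Vec A n → Vec A n → Subset n
  differ []      []      = []
  differ (x ∷ u) (y ∷ v) = (if does (x ≟ y) then outside else inside) ∷ differ u v

  ∈-differ⁺ : ∀ {u v : Vec A n} i → lookup u i ≢ lookup v i → i ∈ differ u v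
  ∈-differ⁺ {u = x ∷ u} {y ∷ v} zero    x≢y with x ≟ y
  ... | yes x≡y = contradiction x≡y x≢y
  ... | no  _   = here
  ∈-differ⁺ {u = x ∷ u} {y ∷ v} (suc i) u≢v = there (∈-differ⁺ i u≢v)

  ∈-differ⁻ : ∀ {u v : Vec A n} i → i ∈ differ u v → lookup u i ≢ lookup v i
  ∈-differ⁻ {u = x ∷ u} {y ∷ v} zero    i∈ with x ≟ y | i∈
  ... | no x≢y | _ = x≢y
  ∈-differ⁻ {u = x ∷ u} {y ∷ v} (suc i) (there i∈) = ∈-differ⁻ i i∈

_≟ʷ_ : ∀ {q n} → DecidableEquality (Word q n)
_≟ʷ_ = ≡-dec _≟ᶠ_

-- If D c were covered by the D b with b ∈ Bs, then c would agree with a wherever a and all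
-- of Bs agree, that is, c ∈ wdesc (a ∷ Bs).
differ-coverFree : ∀ {q n} r (a : Word q n) L → WideSenseFrameproof (suc r) (a ∷ L) →
  CoverFree (differ _≟ᶠ_ a) r L
differ-coverFree {q} {n} r a L ((a∉L ∷ _) , frameproof) {c} c∈L Bs Bs-others ∣Bs∣≤r Dc⊆⋃
  with frameproof X X-distinct tt ∣X∣≤1+r X⊆a∷L c (there c∈L) c∈wdesc
  where
  X : List (Word q n)
  X = a ∷ deduplicate _≟ʷ_ Bs
  Bs⊆L : ∀ {b} → b ∈ₗ deduplicate _≟ʷ_ Bs → b ∈ₗ L
  Bs⊆L b∈ = proj₁ (All.lookup Bs-others (∈-deduplicate⁻ _≟ʷ_ Bs b∈))
  X-distinct : Unique X
  X-distinct = All.tabulate (All.lookup a∉L ∘ Bs⊆L) ∷ deduplicate-! _≟ʷ_ Bs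
  ∣X∣≤1+r : length X ≤ suc r
  ∣X∣≤1+r = s≤s (≤-trans (length-deduplicate _≟ʷ_ Bs) ∣Bs∣≤r)
  X⊆a∷L : ∀ x → x ∈ₗ X → x ∈ₗ a ∷ L
  X⊆a∷L x (here x≡a) = here x≡a
  X⊆a∷L x (there x∈) = there (Bs⊆L x∈)
  c∈wdesc : InWdesc X c
  c∈wdesc i undetectable x x∈X = trans c≡a (undetectable a x (here refl) x∈X)
    where
    c≡a : lookup c i ≡ lookup a i
    c≡a with lookup a i ≟ᶠ lookup c i
    ... | yes a≡c = sym a≡c
    ... | no  a≢c
      with find (Any.map⁻ (x∈⋃ps⁻ (map (differ _≟ᶠ_ a) Bs) (Dc⊆⋃ (∈-differ⁺ _≟ᶠ_ i a≢c))))
    ... | b , b∈Bs , i∈Db = contradiction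
      (undetectable a b (here refl) (there (∈-deduplicate⁺ _≟ʷ_ b∈Bs))) (∈-differ⁻ _≟ᶠ_ i i∈Db)
... | here  c≡a = All.lookup a∉L c∈L (sym c≡a)
... | there c∈  = proj₂ (All.lookup Bs-others (∈-deduplicate⁻ _≟ʷ_ Bs c∈)) refl

-- Opened only here: ℤ's prefix +_ and -_ make sections of ℕ such as (c +_) ambiguous.
open import Data.Integer using (ℤ; +_; -[1+_]; -_; _-_; _/ℕ_; _%ℕ_)
  renaming (_+_ to _+ℤ_; _*_ to _*ℤ_)
open import Data.Integer.DivMod using (a≡a%ℕn+[a/ℕn]*n; n%ℕd<d)
import Data.Integer.Properties as ℤ
import Data.Integer.Tactic.RingSolver as ℤ-Solver

ceilDiv-spec : ∀ a B → 0 < B → ∃[ R ] R < B × ceilDiv a B *ℤ + B ≡ a +ℤ + R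
ceilDiv-spec a B@(suc _) _ = R , n%ℕd<d (- a) B , (begin
  - Q *ℤ + B                 ≡⟨ lemma₁ Q (+ B) (+ R) ⟩
  + R - (+ R +ℤ Q *ℤ + B)    ≡⟨ cong (_-_ (+ R)) (a≡a%ℕn+[a/ℕn]*n (- a) B) ⟨
  + R - - a                  ≡⟨ lemma₂ a (+ R) ⟩
  a +ℤ + R                   ∎)
  where
  open ≡-Reasoning
  Q : ℤ
  Q = (- a) /ℕ B
  R : ℕ
  R = (- a) %ℕ B
  lemma₁ : ∀ q B R → - q *ℤ B ≡ R - (R +ℤ q *ℤ B)
  lemma₁ = ℤ-Solver.solve-∀
  lemma₂ : ∀ a R → R - - a ≡ a +ℤ R
  lemma₂ = ℤ-Solver.solve-∀

ceilDiv-pos : ∀ {n r k B R} → + k *ℤ + B ≡ + n +ℤ + 1 - + suc r +ℤ + R → r + B * k ≡ n + R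
ceilDiv-pos {n} {r} {k} {B} {R} eq = ℤ.+-injective (begin
  + r +ℤ + (B * k)                          ≡⟨ cong (λ m → + r +ℤ + m) (*-comm B k) ⟩
  + r +ℤ + (k * B)                          ≡⟨ cong (+ r +ℤ_) (ℤ.pos-* k B) ⟩
  + r +ℤ + k *ℤ + B                         ≡⟨ cong (+ r +ℤ_) eq ⟩
  + r +ℤ (+ n +ℤ + 1 - + suc r +ℤ + R)      ≡⟨ lemma (+ r) (+ n) (+ R) ⟩
  + n +ℤ + R                                ∎)
  where
  open ≡-Reasoning
  lemma : ∀ r n R → r +ℤ (n +ℤ + 1 - (+ 1 +ℤ r) +ℤ R) ≡ n +ℤ R
  lemma = ℤ-Solver.solve-∀

ceilDiv-neg : ∀ {n r j B R} → -[1+ j ] *ℤ + B ≡ + n +ℤ + 1 - + suc r +ℤ + R → n + R + suc j * B ≡ r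
ceilDiv-neg {n} {r} {j} {B} {R} eq = ℤ.+-injective (begin
  + n +ℤ + R +ℤ + (suc j * B)     ≡⟨ cong (+ n +ℤ + R +ℤ_) (ℤ.pos-* (suc j) B) ⟩
  + n +ℤ + R +ℤ + suc j *ℤ + B    ≡⟨ lemma₁ (+ n) (+ R) (+ suc j) (+ B) (+ r) ⟩
  E - - + suc j *ℤ + B +ℤ + r     ≡⟨ cong (λ e → E - e +ℤ + r) eq ⟩
  E - E +ℤ + r                    ≡⟨ lemma₂ E (+ r) ⟩
  + r                             ∎)
  where
  open ≡-Reasoning
  E : ℤ
  E = + n +ℤ + 1 - + suc r +ℤ + R
  lemma₁ : ∀ n R S B r → n +ℤ R +ℤ S *ℤ B ≡ (n +ℤ + 1 - (+ 1 +ℤ r) +ℤ R) - - S *ℤ B +ℤ r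
  lemma₁ = ℤ-Solver.solve-∀
  lemma₂ : ∀ e r → e - e +ℤ r ≡ r
  lemma₂ = ℤ-Solver.solve-∀

t≤tC2 : ∀ {t} → 3 ≤ t → t ≤ t C 2
t≤tC2 {suc (suc (suc s))} (s≤s (s≤s (s≤s z≤n))) = begin
  suc (suc (suc s))               ≡⟨ +-comm 1 (suc (suc s)) ⟩
  suc (suc s) + 1                 ≤⟨ +-monoʳ-≤ (suc (suc s)) 1≤[2+s]C2 ⟩
  suc (suc s) + suc (suc s) C 2   ≡⟨ [1+m]C2≡m+mC2 (suc (suc s)) ⟨
  suc (suc (suc s)) C 2           ∎
  where
  open ≤-Reasoning
  1≤[2+s]C2 : 1 ≤ suc (suc s) C 2
  1≤[2+s]C2 = subst (1 ≤_) (sym ([1+m]C2≡m+mC2 (suc s))) (s≤s z≤n)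

r+Bk≡n+R⇒2k≤n : ∀ {n r k B R} → 1 ≤ r → 2 ≤ B → R < B → r + B * k ≡ n + R → k + k ≤ n
r+Bk≡n+R⇒2k≤n {k = zero} _ _ _ _ = z≤n
r+Bk≡n+R⇒2k≤n {n} {r} {suc j} {B} {R} 1≤r 2≤B R<B eq = begin
  suc j + suc j        ≡⟨ double j ⟩
  suc (1 + j * 2)      ≤⟨ s≤s (+-mono-≤ 1≤r (≤-trans (*-monoʳ-≤ j 2≤B) (≤-reflexive (*-comm j B)))) ⟩
  suc (r + B * j)      ≤⟨ +-cancelʳ-≤ B _ _ (begin
    suc (r + B * j) + B  ≡⟨ shift r B j ⟩
    suc (r + B * suc j)  ≡⟨ cong suc eq ⟩
    suc (n + R)          ≡⟨ +-suc n R ⟨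
    n + suc R            ≤⟨ +-monoʳ-≤ n R<B ⟩
    n + B                ∎) ⟩
  n                    ∎
  where
  open ≤-Reasoning
  double : ∀ j → suc j + suc j ≡ suc (1 + j * 2)
  double = solve-∀
  shift : ∀ r B j → suc (r + B * j) + B ≡ suc (r + B * suc j)
  shift = solve-∀

theorem1p8 : ∀ (q n t : ℕ) → 2 ≤ q → 1 ≤ n → 3 ≤ t →
    (𝒞 : List (Word q n)) → WideSenseFrameproof t 𝒞 →
    length 𝒞 ≤ binomℤ n (ceilDiv ((+ n +ℤ + 1) - + t) (t C 2)) + t
theorem1p8 q n t       _ _ _   []      _ = z≤n
theorem1p8 q n (suc r) _ _ 3≤t (a ∷ L) frameproof@((_ ∷ L-distinct) , _)
  with ceilDiv (+ n +ℤ + 1 - + suc r) (suc r C 2)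
     | ceilDiv-spec (+ n +ℤ + 1 - + suc r) (suc r C 2) (≤-trans (s≤s z≤n) (t≤tC2 3≤t))
... | + k      | R , R<B , eq = ≤-trans (s≤s family-bound) (≤-reflexive (sym (+-suc (n C k) r)))
  where
  r+Bk≡n+R : r + (suc r C 2) * k ≡ n + R
  r+Bk≡n+R = ceilDiv-pos {n} {r} {k} {suc r C 2} {R} eq
  2k≤n : k + k ≤ n
  2k≤n = r+Bk≡n+R⇒2k≤n (≤-trans (s≤s z≤n) (≤-pred 3≤t))
    (≤-trans (n≤1+n 2) (≤-trans 3≤t (t≤tC2 3≤t))) R<B r+Bk≡n+R
  family-bound : length L ≤ n C k + r
  family-bound = CoverFreeFamily.length≤nCk+r _≟ʷ_ (differ _≟ᶠ_ a) L r k
    (differ-coverFree r a L frameproof) L-distinct 2k≤n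
    (≤-trans (m≤m+n n R) (≤-reflexive (sym r+Bk≡n+R)))
... | -[1+ j ] | R , R<B , eq = ⊥-elim (1+n≰n (begin
  suc r              ≤⟨ t≤tC2 3≤t ⟩
  B                  ≤⟨ m≤m+n B (j * B) ⟩
  suc j * B          ≤⟨ m≤n+m (suc j * B) (n + R) ⟩
  n + R + suc j * B  ≡⟨ ceilDiv-neg {n} {r} {j} {B} {R} eq ⟩
  r                  ∎))
  where
  open ≤-Reasoning
  B : ℕ
  B = suc r C 2
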